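{- Let $\mathcal B,\mathcal B^*$ be pre-matroids on a finite set $X$ and $L:\mathcal B\to\mathcal B^*$, $B\mapsto B^*$, a linking. Let $S$ be an almost-basis of $\mathcal B$ and $A$ an almost-basis of $\mathcal B^*$. Suppose $x,y\in U(S)$ with $x\ne y$. If $(S+x)^*=A+y$, then $x\in U^*(A)$.
   Context: A pre-matroid on a finite set $X$ is a non-empty set of subsets of $X$ (bases). For $Y\subseteq X$, $x\notin Y$, $Y+x=Y\cup\{x\}$; for $y\in Y$, $Y-y=Y\setminus\{y\}$ (so writing $A+y$ presupposes $y\notin A$). An almost-basis of $\mathcal B$ is $B-x$ with $B\in\mathcal B$, $x\in B$; for it $U(D)=\{x\notin D: D+x\in\mathcal B\}$; similarly for $\mathcal B^*$ with $U^*(D)=\{x\notin D: D+x\in\mathcal B^*\}$. A transposition of $X$ exchanges two distinct elements and fixes the rest; it acts on subsets elementwise. A bijection $\mathcal B\to\mathcal B^*$, $B\mapsto B^*$, is a linking if for all $B\in\mathcal B$ and transpositions $\tau$: (L1) if $\tau(B)\in\mathcal B$ then $\tau(B^*)\in\mathcal B^*$ and $\tau(B^*)=\tau(B)^*$; (L2) if $\tau(B^*)\in\mathcal B^*$ then $\tau(B)\in\mathcal B$ and $\tau(B^*)=\tau(B)^*$. -}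

module Defs where

open import Data.Nat using (ℕ)
open import Data.Bool using (Bool; T)
open import Data.Fin using (Fin)
open import Data.Fin.Subset using (Subset; inside; outside; _∈_; _∉_)
open import Data.Fin.Permutation.Components using (transpose)
open import Data.Vec using (tabulate; lookup; _[_]≔_)
open import Data.Product using (Σ; ∃; _×_; proj₁; _,_)
open import Relation.Binary.PropositionalEquality using (_≡_; _≢_)
open import Function.Bundles using (_⤖_; Bijection)

-- A family of subsets of X = Fin n, given by its (Boolean) characteristic
-- function; B is a member iff T (𝓑 B).
Family : ℕ → Set
Family n = Subset n → Bool

IsPreMatroid : ∀ {n} → Family n → Set
IsPreMatroid 𝓑 = ∃ λ B → T (𝓑 B)

Basis : ∀ {n} → Family n → Set
Basis {n} 𝓑 = Σ (Subset n) (λ B → T (𝓑 B))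

_+ₛ_ : ∀ {n} → Subset n → Fin n → Subset n
Y +ₛ x = Y [ x ]≔ inside

_-ₛ_ : ∀ {n} → Subset n → Fin n → Subset n
Y -ₛ y = Y [ y ]≔ outside

-- Action of the transposition (i j) on a subset (elementwise image).
-- Since the transposition is an involution, k ∈ τ(S) iff τ(k) ∈ S.
swapₛ : ∀ {n} → Fin n → Fin n → Subset n → Subset n
swapₛ i j S = tabulate (λ k → lookup S (transpose i j k))

AlmostBasis : ∀ {n} → Family n → Subset n → Set
AlmostBasis 𝓑 D = ∃ λ B → ∃ λ z → T (𝓑 B) × z ∈ B × D ≡ B -ₛ z

InU : ∀ {n} → Family n → Subset n → Fin n → Set
InU 𝓑 D x = x ∉ D × T (𝓑 (D +ₛ x))

record Linking {n} (𝓑 𝓑* : Family n) : Set where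
  field
    bij : Basis 𝓑 ⤖ Basis 𝓑*

  star : (B : Subset n) → T (𝓑 B) → Subset n
  star B p = proj₁ (Bijection.to bij (B , p))

  field
    L1 : (B : Subset n) (p : T (𝓑 B)) (i j : Fin n) → i ≢ j →
         (q : T (𝓑 (swapₛ i j B))) →
         T (𝓑* (swapₛ i j (star B p))) × swapₛ i j (star B p) ≡ star (swapₛ i j B) q
    L2 : (B : Subset n) (p : T (𝓑 B)) (i j : Fin n) → i ≢ j →
         T (𝓑* (swapₛ i j (star B p))) →
         Σ (T (𝓑 (swapₛ i j B))) λ q → swapₛ i j (star B p) ≡ star (swapₛ i j B) q

-- Let τ be the transposition (x y). It carries the basis S + x to the basis S + y, so by (L1)
-- the set τ(A + y) = τ((S + x)*) is a basis of 𝓑*, namely (S + y)*. If x ∉ A then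
-- τ(A + y) = A + x, which is the claim. If x ∈ A then τ fixes A + y, so (S + y)* = (S + x)*,
-- and injectivity of the linking gives S + y = S + x, impossible since x ∉ S.
module Submission where

open import Defs
open import Data.Bool using (T)
open import Data.Bool.Properties using (T-irrelevant)
open import Data.Empty using (⊥-elim)
open import Data.Fin using (Fin)
open import Data.Fin.Properties using (_≟_)
open import Data.Fin.Permutation.Components using (transpose)
open import Data.Fin.Subset using (Subset; _∈_; _∉_; inside; outside)
open import Data.Fin.Subset.Properties using (_∈?_)
open import Data.Nat using (ℕ)
open import Data.Product using (_×_; _,_; proj₁; proj₂)
open import Data.Vec using (lookup; _[_]≔_)
open import Data.Vec.Properties
  using (tabulate∘lookup; tabulate-cong; lookup∘update; lookup∘update′;
         []≔-idempotent; []≔-commutes; []≔-lookup; lookup⇒[]=; []=⇒lookup)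
open import Function using (_∘_)
open import Function.Bundles using (Bijection)
open import Relation.Nullary using (Dec; yes; no)
open import Relation.Nullary.Decidable using (dec-true; dec-false)
open import Relation.Binary.PropositionalEquality
  using (_≡_; _≢_; refl; sym; trans; cong; cong₂; subst; module ≡-Reasoning)

private
  variable
    n : ℕ

transpose-matchˡ : (i j : Fin n) → transpose i j i ≡ j
transpose-matchˡ i j rewrite dec-true (i ≟ i) refl = refl

transpose-matchʳ : {i j : Fin n} → i ≢ j → transpose i j j ≡ i
transpose-matchʳ {i = i} {j} i≢j
  rewrite dec-false (j ≟ i) (i≢j ∘ sym) | dec-true (j ≟ j) refl = refl

transpose-fix : {i j k : Fin n} → k ≢ i → k ≢ j → transpose i j k ≡ k
transpose-fix {i = i} {j} {k} k≢i k≢j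
  rewrite dec-false (k ≟ i) k≢i | dec-false (k ≟ j) k≢j = refl

lookup-∉ : {x : Fin n} {p : Subset n} → x ∉ p → lookup p x ≡ outside
lookup-∉ {x = x} {p} x∉p with lookup p x in eq
... | outside = refl
... | inside  = ⊥-elim (x∉p (lookup⇒[]= x p eq))

swapₛ-update : {i j : Fin n} → i ≢ j → (V : Subset n) →
               swapₛ i j V ≡ (V [ i ]≔ lookup V j) [ j ]≔ lookup V i
swapₛ-update {n = n} {i = i} {j} i≢j V =
  trans (tabulate-cong (λ k → by-position k (k ≟ i) (k ≟ j))) (tabulate∘lookup V′)
  where
  V′ : Subset n
  V′ = (V [ i ]≔ lookup V j) [ j ]≔ lookup V i

  by-position : ∀ k → Dec (k ≡ i) → Dec (k ≡ j) →
                lookup V (transpose i j k) ≡ lookup V′ k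
  by-position .i (yes refl) _ = trans (cong (lookup V) (transpose-matchˡ i j))
    (sym (trans (lookup∘update′ i≢j (V [ i ]≔ lookup V j) (lookup V i))
                (lookup∘update i V (lookup V j))))
  by-position .j (no _) (yes refl) = trans (cong (lookup V) (transpose-matchʳ i≢j))
    (sym (lookup∘update j (V [ i ]≔ lookup V j) (lookup V i)))
  by-position k (no k≢i) (no k≢j) = trans (cong (lookup V) (transpose-fix k≢i k≢j))
    (sym (trans (lookup∘update′ k≢j (V [ i ]≔ lookup V j) (lookup V i))
                (lookup∘update′ k≢i V (lookup V j))))

swapₛ-comm : {i j : Fin n} → i ≢ j → (V : Subset n) → swapₛ i j V ≡ swapₛ j i V
swapₛ-comm {i = i} {j} i≢j V = begin
  swapₛ i j V                              ≡⟨ swapₛ-update i≢j V ⟩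
  (V [ i ]≔ lookup V j) [ j ]≔ lookup V i  ≡⟨ []≔-commutes V i j i≢j ⟩
  (V [ j ]≔ lookup V i) [ i ]≔ lookup V j  ≡⟨ swapₛ-update (i≢j ∘ sym) V ⟨
  swapₛ j i V                              ∎
  where open ≡-Reasoning

swapₛ-fixes : {i j : Fin n} → i ≢ j → (V : Subset n) → lookup V i ≡ lookup V j →
              swapₛ i j V ≡ V
swapₛ-fixes {i = i} {j} i≢j V Vi≡Vj = begin
  swapₛ i j V
    ≡⟨ swapₛ-update i≢j V ⟩
  (V [ i ]≔ lookup V j) [ j ]≔ lookup V i
    ≡⟨ cong₂ (λ a b → (V [ i ]≔ a) [ j ]≔ b) (sym Vi≡Vj) Vi≡Vj ⟩
  (V [ i ]≔ lookup V i) [ j ]≔ lookup V j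
    ≡⟨ cong (_[ j ]≔ lookup V j) ([]≔-lookup V i) ⟩
  V [ j ]≔ lookup V j
    ≡⟨ []≔-lookup V j ⟩
  V ∎
  where open ≡-Reasoning

swapₛ-moves : {i j : Fin n} → i ≢ j → (V : Subset n) → lookup V i ≡ lookup V j →
              ∀ b → swapₛ i j (V [ i ]≔ b) ≡ V [ j ]≔ b
swapₛ-moves {n = n} {i = i} {j} i≢j V Vi≡Vj b = begin
  swapₛ i j W
    ≡⟨ swapₛ-update i≢j W ⟩
  (W [ i ]≔ lookup W j) [ j ]≔ lookup W i
    ≡⟨ cong₂ (λ a c → (W [ i ]≔ a) [ j ]≔ c) (lookup∘update′ (i≢j ∘ sym) V b)
                                              (lookup∘update i V b) ⟩
  (W [ i ]≔ lookup V j) [ j ]≔ b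
    ≡⟨ cong (_[ j ]≔ b) ([]≔-idempotent V i) ⟩
  (V [ i ]≔ lookup V j) [ j ]≔ b
    ≡⟨ cong (λ a → (V [ i ]≔ a) [ j ]≔ b) (sym Vi≡Vj) ⟩
  (V [ i ]≔ lookup V i) [ j ]≔ b
    ≡⟨ cong (_[ j ]≔ b) ([]≔-lookup V i) ⟩
  V [ j ]≔ b ∎
  where
  open ≡-Reasoning
  W : Subset n
  W = V [ i ]≔ b

swapₛ-+ₛ : {i j : Fin n} → i ≢ j → (V : Subset n) → i ∉ V → j ∉ V →
           swapₛ i j (V +ₛ i) ≡ V +ₛ j
swapₛ-+ₛ i≢j V i∉V j∉V = swapₛ-moves i≢j V (trans (lookup-∉ i∉V) (sym (lookup-∉ j∉V))) inside

swapₛ-fixes-+ₛ : {i j : Fin n} → i ≢ j → (V : Subset n) → i ∈ V → swapₛ i j (V +ₛ j) ≡ V +ₛ j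
swapₛ-fixes-+ₛ {j = j} i≢j V i∈V = swapₛ-fixes i≢j (V +ₛ j)
  (trans (lookup∘update′ i≢j V inside)
         (trans ([]=⇒lookup i∈V) (sym (lookup∘update j V inside))))

+ₛ-injectiveʳ : {S : Subset n} {x y : Fin n} → x ∉ S → S +ₛ x ≡ S +ₛ y → x ≡ y
+ₛ-injectiveʳ {S = S} {x} {y} x∉S S+x≡S+y with x ≟ y
... | yes x≡y = x≡y
... | no x≢y with trans (sym (lookup∘update x S inside))
                        (trans (cong (λ V → lookup V x) S+x≡S+y)
                               (trans (lookup∘update′ x≢y S inside) (lookup-∉ x∉S)))
...   | ()

module _ {𝓑 𝓑* : Family n} (L : Linking 𝓑 𝓑*) where
  open Linking L

  star-injective : {B C : Subset n} (p : T (𝓑 B)) (q : T (𝓑 C)) →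
                   star B p ≡ star C q → B ≡ C
  star-injective p q p*≡q* = cong proj₁ (Bijection.injective bij (basis-≡ p*≡q*))
    where
    basis-≡ : ∀ {𝓒} {u v : Basis 𝓒} → proj₁ u ≡ proj₁ v → u ≡ v
    basis-≡ {u = B , p} {C , q} refl = cong (B ,_) (T-irrelevant p q)

lemma4p2 : ∀ {n} (𝓑 𝓑* : Family n) → IsPreMatroid 𝓑 → IsPreMatroid 𝓑* →
           (L : Linking 𝓑 𝓑*) → (S A : Subset n) →
           AlmostBasis 𝓑 S → AlmostBasis 𝓑* A →
           (x y : Fin n) → (hx : InU 𝓑 S x) → InU 𝓑 S y → x ≢ y →
           y ∉ A → Linking.star L (S +ₛ x) (proj₂ hx) ≡ A +ₛ y →
           InU 𝓑* A x
lemma4p2 𝓑 𝓑* _ _ L S A _ _ x y (x∉S , S+x∈𝓑) (y∉S , S+y∈𝓑) x≢y y∉A S+x*≡A+y =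
  by-cases (x ∈? A)
  where
  open Linking L

  τS+x≡S+y : swapₛ x y (S +ₛ x) ≡ S +ₛ y
  τS+x≡S+y = swapₛ-+ₛ x≢y S x∉S y∉S

  τS+x∈𝓑 : T (𝓑 (swapₛ x y (S +ₛ x)))
  τS+x∈𝓑 = subst (T ∘ 𝓑) (sym τS+x≡S+y) S+y∈𝓑

  τ-linked : T (𝓑* (swapₛ x y (star (S +ₛ x) S+x∈𝓑))) ×
             swapₛ x y (star (S +ₛ x) S+x∈𝓑) ≡ star (swapₛ x y (S +ₛ x)) τS+x∈𝓑
  τ-linked = L1 (S +ₛ x) S+x∈𝓑 x y x≢y τS+x∈𝓑

  τA+y∈𝓑* : T (𝓑* (swapₛ x y (A +ₛ y)))
  τA+y∈𝓑* = subst (T ∘ 𝓑* ∘ swapₛ x y) S+x*≡A+y (proj₁ τ-linked)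

  τA+y≡τ[S+x]* : swapₛ x y (A +ₛ y) ≡ star (swapₛ x y (S +ₛ x)) τS+x∈𝓑
  τA+y≡τ[S+x]* = trans (cong (swapₛ x y) (sym S+x*≡A+y)) (proj₂ τ-linked)

  by-cases : Dec (x ∈ A) → InU 𝓑* A x
  by-cases (no x∉A) = x∉A , subst (T ∘ 𝓑*) τA+y≡A+x τA+y∈𝓑*
    where
    τA+y≡A+x : swapₛ x y (A +ₛ y) ≡ A +ₛ x
    τA+y≡A+x = trans (swapₛ-comm x≢y (A +ₛ y)) (swapₛ-+ₛ (x≢y ∘ sym) A y∉A x∉A)
  by-cases (yes x∈A) = ⊥-elim (x≢y (+ₛ-injectiveʳ x∉S (trans S+x≡τS+x τS+x≡S+y)))
    where
    S+x≡τS+x : S +ₛ x ≡ swapₛ x y (S +ₛ x)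
    S+x≡τS+x = star-injective L S+x∈𝓑 τS+x∈𝓑
      (trans S+x*≡A+y (trans (sym (swapₛ-fixes-+ₛ x≢y A x∈A)) τA+y≡τ[S+x]*))
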